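{- Let $k\ge 2$ and let $G=(V,E)$ be a finite simple graph. Then the facets of the total $(k+1)$-cut complex $\Delta^t_{k+1}(G)$ are precisely the ridges of $\Delta^t_k(G)$ that are contained in exactly $k+1$ facets of $\Delta^t_k(G)$.
   Context: For $j\ge 1$, the total $j$-cut complex $\Delta_j^t(G)$ is the simplicial complex on $V$ whose facets are the sets $V\setminus S$ where $S$ is an independent set of $G$ (no two vertices adjacent) of size $j$. When nonvoid it is pure of dimension $|V|-j-1$. A ridge of a pure simplicial complex is a face of dimension one less than the dimension of the complex. -}

module Defs where

open import Data.Nat using (ℕ; suc; _+_)
open import Data.Fin using (Fin)
open import Data.Fin.Subset using (Subset; _∈_; _⊆_; ∁; ∣_∣)
open import Data.Bool using (Bool; true; false)
open import Data.List using (List; length)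
open import Data.List.Relation.Unary.Unique.Propositional using (Unique)
import Data.List.Membership.Propositional as LM
open import Data.Product using (Σ; ∃; _×_)
open import Relation.Binary.PropositionalEquality using (_≡_)
open import Function.Bundles using (_⇔_)

record Graph (n : ℕ) : Set where
  field
    adj      : Fin n → Fin n → Bool
    adj-sym  : ∀ u v → adj u v ≡ adj v u
    adj-irr  : ∀ v → adj v v ≡ false
open Graph public

Independent : ∀ {n} → Graph n → Subset n → Set
Independent G S = ∀ u v → u ∈ S → v ∈ S → adj G u v ≡ false

-- F is a facet of the total j-cut complex Δ_j^t(G):
-- F = V ∖ S for an independent set S of size j.
IsFacet : ∀ {n} → Graph n → ℕ → Subset n → Set
IsFacet G j F = ∃ λ S → Independent G S × ∣ S ∣ ≡ j × F ≡ ∁ S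

IsFace : ∀ {n} → Graph n → ℕ → Subset n → Set
IsFace G j σ = ∃ λ F → IsFacet G j F × σ ⊆ F

-- σ is a ridge of Δ_j^t(G): a face of dimension (|V| - j - 1) - 1,
-- i.e. with |σ| = |V| - j - 1 (stated without truncated subtraction).
IsRidge : ∀ {n} → Graph n → ℕ → Subset n → Set
IsRidge {n} G j σ = IsFace G j σ × ∣ σ ∣ + j + 1 ≡ n

ExactlyN : ∀ {n} → ℕ → (Subset n → Set) → Set
ExactlyN {n} m P =
  Σ (List (Subset n)) λ xs →
    Unique xs × length xs ≡ m × (∀ F → (F LM.∈ xs) ⇔ P F)

{-# OPTIONS --safe #-}
-- Write σ = V ∖ S with |S| = k + 1.  A facet of Δ_k containing σ is V ∖ T with T ⊆ S independent
-- of size k, i.e. T = S ∖ {x} for some x ∈ S; so there are k + 1 of them exactly when every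
-- S ∖ {x} is independent.  This holds when S is independent; if S contains an edge uv, then
-- S ∖ {x} is independent only for x ∈ {u, v}, leaving at most 2 < k + 1 facets.
module Submission where

open import Defs

open import Algebra.Lattice.Properties.BooleanAlgebra using (¬-involutive)
open import Data.Bool using (true; false)
open import Data.Empty using (⊥; ⊥-elim)
open import Data.Fin using (Fin)
open import Data.Fin.Subset using (Subset; _⊆_; ∁; ∣_∣; _-_; _∈_; _∉_)
open import Data.Fin.Subset.Properties
  using ( ⊆-refl; drop-∷-⊆; out⊆; in⊆in; p⊆q⇒∣p∣≤∣q∣; ∁p⊆∁q⇒p⊇q; x∉p⇒x∈∁p; x∈∁p⇒x∉p
        ; x∈p∧x≢y⇒x∈p-y; x∈p⇒∣p-x∣<∣p∣; _∈?_; ∪-∩-booleanAlgebra )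
open import Data.List using (List; []; _∷_; length; map)
open import Data.List.Properties using (length-map)
open import Data.List.Membership.Propositional using () renaming (_∈_ to _∈ₗ_)
open import Data.List.Membership.Propositional.Properties using (∈-map⁺; ∈-map⁻)
open import Data.List.Relation.Unary.All as All using (_∷_)
import Data.List.Relation.Unary.All.Properties as All
open import Data.List.Relation.Unary.Any using (here; there)
open import Data.List.Relation.Unary.AllPairs using ([]; _∷_)
open import Data.List.Relation.Unary.Unique.Propositional using (Unique)
import Data.List.Relation.Unary.Unique.Propositional.Properties as Unique
open import Data.Nat using (ℕ; suc; _+_; _≤_; z≤n; s≤s; s≤s⁻¹)
open import Data.Nat.Properties
  using (+-suc; +-assoc; +-comm; +-cancelˡ-≡; suc-injective; ≤-trans; ≤-reflexive; n≮n)
open import Data.Product using (_×_; ∃; _,_; proj₁)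
open import Data.Sum as Sum using (_⊎_; inj₁; inj₂)
open import Data.Vec using ([]; _∷_; here; there)
open import Data.Vec.Properties using (∷-injectiveʳ)
open import Function.Bundles using (_⇔_; mk⇔; Equivalence)
open import Relation.Nullary using (yes; no)
open import Relation.Binary.PropositionalEquality using (_≡_; refl; sym; trans; cong; subst)

open Equivalence

private
  variable
    n k : ℕ

∁-involutive : (p : Subset n) → ∁ (∁ p) ≡ p
∁-involutive {n} = ¬-involutive (∪-∩-booleanAlgebra n)

∁p≡q⇒p≡∁q : {p q : Subset n} → ∁ p ≡ q → p ≡ ∁ q
∁p≡q⇒p≡∁q {p = p} e = trans (sym (∁-involutive p)) (cong ∁ e)

∁-injective : {p q : Subset n} → ∁ p ≡ ∁ q → p ≡ q
∁-injective {q = q} e = trans (∁p≡q⇒p≡∁q e) (∁-involutive q)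

∣p∣+∣∁p∣≡n : (p : Subset n) → ∣ p ∣ + ∣ ∁ p ∣ ≡ n
∣p∣+∣∁p∣≡n []          = refl
∣p∣+∣∁p∣≡n (true ∷ p)  = cong suc (∣p∣+∣∁p∣≡n p)
∣p∣+∣∁p∣≡n (false ∷ p) = trans (+-suc ∣ p ∣ ∣ ∁ p ∣) (cong suc (∣p∣+∣∁p∣≡n p))

p⊆∁q⇒q⊆∁p : {p q : Subset n} → p ⊆ ∁ q → q ⊆ ∁ p
p⊆∁q⇒q⊆∁p p⊆∁q x∈q = x∉p⇒x∈∁p (λ x∈p → x∈∁p⇒x∉p (p⊆∁q x∈p) x∈q)

p⊆q∧∣q∣≤∣p∣⇒p≡q : {p q : Subset n} → p ⊆ q → ∣ q ∣ ≤ ∣ p ∣ → p ≡ q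
p⊆q∧∣q∣≤∣p∣⇒p≡q {p = []}        {[]}        _   _       = refl
p⊆q∧∣q∣≤∣p∣⇒p≡q {p = true ∷ p}  {true ∷ q}  p⊆q (s≤s le) =
  cong (true ∷_) (p⊆q∧∣q∣≤∣p∣⇒p≡q (drop-∷-⊆ p⊆q) le)
p⊆q∧∣q∣≤∣p∣⇒p≡q {p = false ∷ p} {false ∷ q} p⊆q le =
  cong (false ∷_) (p⊆q∧∣q∣≤∣p∣⇒p≡q (drop-∷-⊆ p⊆q) le)
p⊆q∧∣q∣≤∣p∣⇒p≡q {p = true ∷ p}  {false ∷ q} p⊆q _ with p⊆q here
... | ()
p⊆q∧∣q∣≤∣p∣⇒p≡q {p = false ∷ p} {true ∷ q}  p⊆q le =
  ⊥-elim (n≮n ∣ q ∣ (≤-trans le (p⊆q⇒∣p∣≤∣q∣ (drop-∷-⊆ p⊆q))))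

p⊆q∧x∉p⇒p≡q-x : {p q : Subset n} {x : Fin n} →
  p ⊆ q → suc ∣ p ∣ ≡ ∣ q ∣ → x ∈ q → x ∉ p → p ≡ q - x
p⊆q∧x∉p⇒p≡q-x {p = p} {q} {x} p⊆q size x∈q x∉p = p⊆q∧∣q∣≤∣p∣⇒p≡q p⊆q-x ∣q-x∣≤∣p∣
  where
  p⊆q-x : p ⊆ q - x
  p⊆q-x y∈p = x∈p∧x≢y⇒x∈p-y (p⊆q y∈p) (λ { refl → x∉p y∈p })
  ∣q-x∣≤∣p∣ : ∣ q - x ∣ ≤ ∣ p ∣
  ∣q-x∣≤∣p∣ = s≤s⁻¹ (subst (suc ∣ q - x ∣ ≤_) (sym size) (x∈p⇒∣p-x∣<∣p∣ x∈q))

deletions : Subset n → List (Subset n)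
deletions []          = []
deletions (true ∷ q)  = (false ∷ q) ∷ map (true ∷_) (deletions q)
deletions (false ∷ q) = map (false ∷_) (deletions q)

length-deletions : (q : Subset n) → length (deletions q) ≡ ∣ q ∣
length-deletions []          = refl
length-deletions (true ∷ q)  = cong suc (trans (length-map _ (deletions q)) (length-deletions q))
length-deletions (false ∷ q) = trans (length-map _ (deletions q)) (length-deletions q)

deletions-unique : (q : Subset n) → Unique (deletions q)
deletions-unique []          = []
deletions-unique (true ∷ q)  =
  All.map⁺ (All.universal (λ _ ()) (deletions q)) ∷ Unique.map⁺ ∷-injectiveʳ (deletions-unique q)
deletions-unique (false ∷ q) = Unique.map⁺ ∷-injectiveʳ (deletions-unique q)

∈-deletions⁺ : {p q : Subset n} → p ⊆ q → suc ∣ p ∣ ≡ ∣ q ∣ → p ∈ₗ deletions q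
∈-deletions⁺ {p = []}        {[]}        _   ()
∈-deletions⁺ {p = true ∷ p}  {true ∷ q}  p⊆q size =
  there (∈-map⁺ _ (∈-deletions⁺ (drop-∷-⊆ p⊆q) (suc-injective size)))
∈-deletions⁺ {p = false ∷ p} {true ∷ q}  p⊆q size
  rewrite p⊆q∧∣q∣≤∣p∣⇒p≡q (drop-∷-⊆ p⊆q) (≤-reflexive (sym (suc-injective size))) = here refl
∈-deletions⁺ {p = false ∷ p} {false ∷ q} p⊆q size = ∈-map⁺ _ (∈-deletions⁺ (drop-∷-⊆ p⊆q) size)
∈-deletions⁺ {p = true ∷ p}  {false ∷ q} p⊆q _ with p⊆q here
... | ()

∈-deletions⁻ : {p q : Subset n} → p ∈ₗ deletions q → p ⊆ q × suc ∣ p ∣ ≡ ∣ q ∣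
∈-deletions⁻ {q = true ∷ q}  (here refl) = out⊆ ⊆-refl , refl
∈-deletions⁻ {q = true ∷ q}  (there m) with ∈-map⁻ _ m
... | p , m′ , refl with ∈-deletions⁻ m′
...   | p⊆q , size = in⊆in p⊆q , cong suc size
∈-deletions⁻ {q = false ∷ q} m with ∈-map⁻ _ m
... | p , m′ , refl with ∈-deletions⁻ m′
...   | p⊆q , size = out⊆ p⊆q , size

∈-map-∁⇔ : {F : Subset n} {xs : List (Subset n)} → F ∈ₗ map ∁ xs ⇔ ∁ F ∈ₗ xs
∈-map-∁⇔ {F = F} {xs} = mk⇔ to′ from′
  where
  to′ : F ∈ₗ map ∁ xs → ∁ F ∈ₗ xs
  to′ m with ∈-map⁻ ∁ m
  ... | p , p∈xs , refl = subst (_∈ₗ xs) (sym (∁-involutive p)) p∈xs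
  from′ : ∁ F ∈ₗ xs → F ∈ₗ map ∁ xs
  from′ m = subst (_∈ₗ map ∁ xs) (∁-involutive F) (∈-map⁺ ∁ m)

ExactlyN-suc⇒∃ : {P : Subset n → Set} → ExactlyN (suc k) P → ∃ P
ExactlyN-suc⇒∃ (F ∷ _ , _ , _ , members) = F , to (members F) (here refl)

unique-⊆-pair⇒length≤2 : {A : Set} {p q : A} (xs : List A) → Unique xs →
  (∀ {x} → x ∈ₗ xs → x ≡ p ⊎ x ≡ q) → length xs ≤ 2
unique-⊆-pair⇒length≤2 []              _ _ = z≤n
unique-⊆-pair⇒length≤2 (_ ∷ [])        _ _ = s≤s z≤n
unique-⊆-pair⇒length≤2 (_ ∷ _ ∷ [])    _ _ = s≤s (s≤s z≤n)
unique-⊆-pair⇒length≤2 (a ∷ b ∷ c ∷ _) ((a≢b ∷ a≢c ∷ _) ∷ (b≢c ∷ _) ∷ _) pair =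
  ⊥-elim (pigeonhole (pair (here refl)) (pair (there (here refl))) (pair (there (there (here refl)))))
  where
  pigeonhole : a ≡ _ ⊎ a ≡ _ → b ≡ _ ⊎ b ≡ _ → c ≡ _ ⊎ c ≡ _ → ⊥
  pigeonhole (inj₁ refl) (inj₁ refl) _           = a≢b refl
  pigeonhole (inj₂ refl) (inj₂ refl) _           = a≢b refl
  pigeonhole (inj₁ refl) (inj₂ _)    (inj₁ refl) = a≢c refl
  pigeonhole (inj₂ refl) (inj₁ _)    (inj₂ refl) = a≢c refl
  pigeonhole (inj₁ _)    (inj₂ refl) (inj₂ refl) = b≢c refl
  pigeonhole (inj₂ _)    (inj₁ refl) (inj₁ refl) = b≢c refl

module _ {n} (G : Graph n) where

  FacetAbove : ℕ → Subset n → Subset n → Set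
  FacetAbove j σ F = IsFacet G j F × σ ⊆ F

  Independent-⊆ : {S T : Subset n} → T ⊆ S → Independent G S → Independent G T
  Independent-⊆ T⊆S ind u v u∈T v∈T = ind u v (T⊆S u∈T) (T⊆S v∈T)

  IsFacet⇔ : {j : ℕ} {σ : Subset n} → IsFacet G j σ ⇔ (Independent G (∁ σ) × ∣ ∁ σ ∣ ≡ j)
  IsFacet⇔ {σ = σ} = mk⇔ to′ from′
    where
    to′ : IsFacet G _ σ → Independent G (∁ σ) × ∣ ∁ σ ∣ ≡ _
    to′ (S , ind , size , refl) rewrite ∁-involutive S = ind , size
    from′ : Independent G (∁ σ) × ∣ ∁ σ ∣ ≡ _ → IsFacet G _ σ
    from′ (ind , size) = ∁ σ , ind , size , sym (∁-involutive σ)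

  ridgeSize⇔ : {j : ℕ} {σ : Subset n} → ∣ σ ∣ + j + 1 ≡ n ⇔ ∣ ∁ σ ∣ ≡ suc j
  ridgeSize⇔ {j} {σ} = mk⇔
    (λ e → sym (+-cancelˡ-≡ ∣ σ ∣ _ _ (trans (sym shift) (trans e (sym (∣p∣+∣∁p∣≡n σ))))))
    (λ e → trans shift (trans (cong (∣ σ ∣ +_) (sym e)) (∣p∣+∣∁p∣≡n σ)))
    where
    shift : ∣ σ ∣ + j + 1 ≡ ∣ σ ∣ + suc j
    shift = trans (+-assoc ∣ σ ∣ j 1) (cong (∣ σ ∣ +_) (+-comm j 1))

  FacetAbove⇔ : {σ F : Subset n} → ∣ ∁ σ ∣ ≡ suc k →
    FacetAbove k σ F ⇔ (∁ F ∈ₗ deletions (∁ σ) × Independent G (∁ F))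
  FacetAbove⇔ {k = k} {σ} {F} size = mk⇔ to′ from′
    where
    to′ : FacetAbove k σ F → ∁ F ∈ₗ deletions (∁ σ) × Independent G (∁ F)
    to′ ((T , ind , ∣T∣≡k , refl) , σ⊆∁T) rewrite ∁-involutive T =
      ∈-deletions⁺ (p⊆∁q⇒q⊆∁p σ⊆∁T) (trans (cong suc ∣T∣≡k) (sym size)) , ind
    from′ : ∁ F ∈ₗ deletions (∁ σ) × Independent G (∁ F) → FacetAbove k σ F
    from′ (m , ind) with ∈-deletions⁻ m
    ... | ∁F⊆∁σ , size′ =
      from IsFacet⇔ (ind , suc-injective (trans size′ size)) , ∁p⊆∁q⇒p⊇q ∁F⊆∁σ

  independent⇒exactlyFacetsAbove : {σ : Subset n} → Independent G (∁ σ) → ∣ ∁ σ ∣ ≡ suc k →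
    ExactlyN (suc k) (FacetAbove k σ)
  independent⇒exactlyFacetsAbove {σ = σ} ind size =
    map ∁ (deletions (∁ σ)) ,
    Unique.map⁺ ∁-injective (deletions-unique (∁ σ)) ,
    trans (length-map ∁ (deletions (∁ σ))) (trans (length-deletions (∁ σ)) size) ,
    λ F → mk⇔
      (λ m → let ∁F∈ = to ∈-map-∁⇔ m in
        from (FacetAbove⇔ size) (∁F∈ , Independent-⊆ (proj₁ (∈-deletions⁻ ∁F∈)) ind))
      (λ above → from ∈-map-∁⇔ (proj₁ (to (FacetAbove⇔ size) above)))

  independent-deletion≡-endpoint : {S T : Subset n} {u v : Fin n} →
    adj G u v ≡ true → u ∈ S → v ∈ S → T ∈ₗ deletions S → Independent G T → T ≡ S - u ⊎ T ≡ S - v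
  independent-deletion≡-endpoint {T = T} {u} {v} uv u∈S v∈S m ind
    with ∈-deletions⁻ m | u ∈? T | v ∈? T
  ... | T⊆S , size | no u∉T | _      = inj₁ (p⊆q∧x∉p⇒p≡q-x T⊆S size u∈S u∉T)
  ... | T⊆S , size | yes _  | no v∉T = inj₂ (p⊆q∧x∉p⇒p≡q-x T⊆S size v∈S v∉T)
  ... | _          | yes u∈T | yes v∈T with trans (sym uv) (ind u v u∈T v∈T)
  ...   | ()

  exactlyFacetsAbove⇒independent : {σ : Subset n} → 2 ≤ k → ∣ ∁ σ ∣ ≡ suc k →
    ExactlyN (suc k) (FacetAbove k σ) → Independent G (∁ σ)
  exactlyFacetsAbove⇒independent {k = k} {σ} 2≤k size (xs , unique , length≡ , members) u v u∈ v∈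
    with adj G u v in uv
  ... | false = refl
  ... | true  = ⊥-elim (n≮n 2 (≤-trans (s≤s 2≤k) (≤-trans (≤-reflexive (sym length≡)) length≤2)))
    where
    twoFacets : ∀ {F} → F ∈ₗ xs → F ≡ ∁ (∁ σ - u) ⊎ F ≡ ∁ (∁ σ - v)
    twoFacets {F} m with to (FacetAbove⇔ size) (to (members F) m)
    ... | ∁F∈ , ind =
      Sum.map ∁p≡q⇒p≡∁q ∁p≡q⇒p≡∁q (independent-deletion≡-endpoint uv u∈ v∈ ∁F∈ ind)
    length≤2 : length xs ≤ 2
    length≤2 = unique-⊆-pair⇒length≤2 xs unique twoFacets

theorem3p1 : ∀ {n} (G : Graph n) (k : ℕ) → 2 ≤ k → (σ : Subset n) →
    IsFacet G (suc k) σ ⇔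
      (IsRidge G k σ × ExactlyN (suc k) (λ F → IsFacet G k F × σ ⊆ F))
theorem3p1 G k 2≤k σ = mk⇔ to′ from′
  where
  to′ : IsFacet G (suc k) σ → IsRidge G k σ × ExactlyN (suc k) (FacetAbove G k σ)
  to′ facet with to (IsFacet⇔ G) facet
  ... | ind , size = (ExactlyN-suc⇒∃ exactly , from (ridgeSize⇔ G {k} {σ}) size) , exactly
    where
    exactly : ExactlyN (suc k) (FacetAbove G k σ)
    exactly = independent⇒exactlyFacetsAbove G ind size
  from′ : IsRidge G k σ × ExactlyN (suc k) (FacetAbove G k σ) → IsFacet G (suc k) σ
  from′ ((_ , ridgeSize) , exactly) =
    from (IsFacet⇔ G) (exactlyFacetsAbove⇒independent G 2≤k size exactly , size)
    where
    size : ∣ ∁ σ ∣ ≡ suc k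
    size = to (ridgeSize⇔ G {k} {σ}) ridgeSize
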